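{- Let $p=(\tau,R)$ be a mesh pattern of length $k$ whose top row is shaded, i.e. $\{(0,k),(1,k),\dots,(k,k)\}\subseteq R$. Then for every permutation $\pi$, $\pi$ avoids $p$ if and only if $\pi^{\uparrow}$ avoids $p^{\uparrow}$. Consequently $p$ and $p^{\uparrow}$ are Wilf-equivalent.
   Context: A permutation of length $n$ is a word $\pi=\pi_1\cdots\pi_n$ using each of $1,\dots,n$ once. A mesh pattern of length $k$ is a pair $(\tau,R)$ with $\tau$ a permutation of length $k$ and $R\subseteq\{0,\dots,k\}\times\{0,\dots,k\}$ (the elements are called shaded boxes). A permutation $\pi$ of length $n$ contains $(\tau,R)$ if there are indices $i_1<\dots<i_k$ such that $\pi_{i_1}\cdots\pi_{i_k}$ is order-isomorphic to $\tau$ and, writing $i_0=0$, $i_{k+1}=n+1$, letting $v_1<\dots<v_k$ be the values $\pi_{i_1},\dots,\pi_{i_k}$ sorted increasingly, $v_0=0$, $v_{k+1}=n+1$, for every $(a,b)\in R$ there is no index $x$ with $i_a<x<i_{a+1}$ and $v_b<\pi_x<v_{b+1}$; otherwise $\pi$ avoids it. The up-shift of a permutation $\pi$ of length $n$ is $\pi^{\uparrow}$ with $\pi^{\uparrow}_i=(\pi_i \bmod n)+1$. The up-shift of a mesh pattern $(\tau,R)$ of length $k$ is $(\tau^{\uparrow},R^{\uparrow})$ with $R^{\uparrow}=\{(a,(b+1)\bmod (k+1)) : (a,b)\in R\}$. Two patterns are Wilf-equivalent if, for every $n$, they are avoided by the same number of permutations of length $n$. -}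

module Defs where

open import Data.Nat using (ℕ; zero; suc)
open import Data.Fin using (Fin; zero; suc; toℕ; fromℕ; fromℕ<; inject₁; _<_)
open import Data.Nat as N using ()
open import Data.Bool using (Bool; true)
open import Data.Maybe using (Maybe; just; nothing)
import Data.Maybe as Maybe
open import Data.Unit using (⊤)
open import Data.Product using (Σ; _×_; ∃)
open import Relation.Nullary using (¬_; yes; no)
open import Relation.Binary.PropositionalEquality using (_≡_)
open import Function using (_⇔_; Injective)

-- Conventions: everything is 0-based.  A permutation of length n is an
-- injective map  Fin n → Fin n  (position ↦ value).

IsPerm : ∀ {n} → (Fin n → Fin n) → Set
IsPerm {n} π = Injective _≡_ _≡_ π

cycSucc : ∀ {n} → Fin n → Fin n
cycSucc {suc m} i with suc (toℕ i) N.<? suc m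
... | yes p = fromℕ< p
... | no _ = zero

cycPred : ∀ {n} → Fin n → Fin n
cycPred {suc m} zero = fromℕ m
cycPred {suc m} (suc j) = inject₁ j

below : ∀ {k} → Fin (suc k) → Maybe (Fin k)
below {zero} _ = nothing
below {suc k} zero = just zero
below {suc k} (suc i) = Maybe.map suc (below i)

-- mesh pattern: underlying pattern τ (a permutation of length k) and the
-- set R of shaded boxes, given by its characteristic function on
-- {0..k} × {0..k}  (first coordinate = column, second = row).
record MeshPattern : Set where
  constructor mesh
  field
    len : ℕ
    τ   : Fin len → Fin len
    R   : Fin (suc len) → Fin (suc len) → Bool
open MeshPattern public

-- up-shift of a permutation: value v ↦ (v+1) mod n (0-based version of
-- π↑_i = (π_i mod n) + 1)
upPerm : ∀ {n} → (Fin n → Fin n) → (Fin n → Fin n)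
upPerm π i = cycSucc (π i)

-- up-shift of a mesh pattern: (a,b) ∈ R ⇔ (a,(b+1) mod (k+1)) ∈ R↑
upMesh : MeshPattern → MeshPattern
upMesh (mesh k τ R) = mesh k (λ i → cycSucc (τ i)) (λ a b → R a (cycPred b))

module _ {n : ℕ} (π : Fin n → Fin n) (p : MeshPattern) where
  private
    k = len p

  module Occ (ι : Fin k → Fin n) where
    -- position x lies strictly between i_a and i_{a+1} (column a)
    InColumn : Fin (suc k) → Fin n → Set
    InColumn a x = Left a × Right a
      where
        Left : Fin (suc k) → Set
        Left zero = ⊤
        Left (suc j) = ι j < x
        Right : Fin (suc k) → Set
        Right a with below a
        ... | nothing = ⊤
        ... | just j = x < ι j

    -- value y lies strictly between v_b and v_{b+1} (row b), where v_{c+1}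
    -- (the (c+1)-th smallest occurrence value) is π(ι j) for τ j = c.
    InRow : Fin (suc k) → Fin n → Set
    InRow b y = Above b × Below b
      where
        Above : Fin (suc k) → Set
        Above zero = ⊤
        Above (suc c) = ∀ j → τ p j ≡ c → π (ι j) < y
        Below : Fin (suc k) → Set
        Below b with below b
        ... | nothing = ⊤
        ... | just c = ∀ j → τ p j ≡ c → y < π (ι j)

  IsOccurrence : (Fin k → Fin n) → Set
  IsOccurrence ι =
    (∀ j j′ → j < j′ → ι j < ι j′) ×
    (∀ j j′ → (π (ι j) < π (ι j′)) ⇔ (τ p j < τ p j′)) ×
    (∀ a b → R p a b ≡ true →
       ¬ (Σ (Fin n) λ x → InColumn a x × InRow b (π x)))
    where open Occ ι

  Contains : Set
  Contains = Σ (Fin k → Fin n) IsOccurrence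

  Avoids : Set
  Avoids = ¬ Contains

Av : ℕ → MeshPattern → Set
Av n p = Σ (Fin n → Fin n) λ π → IsPerm π × Avoids π p

-- Wilf-equivalence: for every n, the sets Av n p and Av n q have the same
-- size, expressed as a bijection (inverse maps) between them, where elements
-- are compared by their underlying permutation (pointwise equality; the
-- proof components are propositions).
WilfEquivalent : MeshPattern → MeshPattern → Set
WilfEquivalent p q = ∀ n →
  Σ (Av n p → Av n q) λ f → Σ (Av n q → Av n p) λ g →
    (∀ x i → Σ.proj₁ (g (f x)) i ≡ Σ.proj₁ x i) ×
    (∀ y i → Σ.proj₁ (f (g y)) i ≡ Σ.proj₁ y i)

-- An occurrence of p in π must use the largest value n, as its point of
-- largest rank k: otherwise the point of value n would lie in the shaded top
-- row.  The up-shift sends this point to the smallest value and rank and raises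
-- all other values and ranks by one, so box (a, b) of the occurrence becomes
-- box (a, b + 1) of the same positions in π↑, and the empty top row becomes the
-- empty bottom row.  Hence the same positions are an occurrence of p↑ in π↑;
-- conversely the shaded bottom row of p↑ forces the value 1 into every
-- occurrence in π↑.  As the up-shift is a bijection on permutations, p and p↑
-- are Wilf-equivalent.
module Submission where

open import Defs
open import Data.Nat using (ℕ)
open import Data.Fin using (Fin; fromℕ)
open import Data.Bool using (true)
open import Data.Product using (_×_)
open import Relation.Binary.PropositionalEquality using (_≡_)
open import Function using (_⇔_; Injective)

open import Data.Bool using (Bool)
open import Data.Empty using (⊥-elim)
open import Data.Fin using (zero; suc; toℕ; fromℕ<; inject₁; punchOut; _<_; _≤_; _≟_)
open import Data.Fin.Properties
  using (toℕ-injective; toℕ-fromℕ; toℕ-fromℕ<; toℕ-inject₁; toℕ<n; ≤fromℕ; ≤∧≢⇒<;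
         <⇒≢; fromℕ≢inject₁; ¬Fin0; <-cmp; any?; pigeonhole; punchOut-injective)
open import Data.Maybe using (just; nothing)
import Data.Nat as ℕ
open import Data.Nat using (zero; suc; z≤n; s≤s; z<s; s<s)
import Data.Nat.Properties as ℕ
open import Data.Product using (∃-syntax; _,_; proj₁)
open import Data.Sum using (inj₁; inj₂)
open import Function using (id; _∘_; mk⇔; Equivalence)
open import Data.Product.Function.NonDependent.Propositional using (_×-⇔_)
open import Function.Related.TypeIsomorphisms using (→-cong-⇔; ¬-cong-⇔)
import Function.Properties.Equivalence as ⇔
open import Relation.Binary using (_Preserves_⟶_; tri<; tri≈; tri>)
open import Relation.Binary.PropositionalEquality
  using (_≢_; refl; sym; trans; cong; subst; subst₂; module ≡-Reasoning)
open import Relation.Nullary using (¬_; yes; no; contradiction)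

open Equivalence using (to; from)

private
  variable
    k m n : ℕ

∀-cong-⇔ : {A : Set} {P Q : A → Set} → (∀ x → P x ⇔ Q x) → (∀ x → P x) ⇔ (∀ x → Q x)
∀-cong-⇔ P⇔Q = mk⇔ (λ f x → to (P⇔Q x) (f x)) (λ g x → from (P⇔Q x) (g x))

inhabited⇒⇔ : {A B : Set} → A → B → A ⇔ B
inhabited⇒⇔ a b = mk⇔ (λ _ → b) (λ _ → a)

empty⇒⇔ : {A B : Set} → ¬ A → ¬ B → A ⇔ B
empty⇒⇔ ¬a ¬b = mk⇔ (λ a → contradiction a ¬a) (λ b → contradiction b ¬b)

⇔-cong-⇔ : {A A′ B B′ : Set} → A ⇔ A′ → B ⇔ B′ → (A ⇔ B) ⇔ (A′ ⇔ B′)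
⇔-cong-⇔ A⇔A′ B⇔B′ = mk⇔
  (λ A⇔B → ⇔.trans (⇔.sym A⇔A′) (⇔.trans A⇔B B⇔B′))
  (λ A′⇔B′ → ⇔.trans A⇔A′ (⇔.trans A′⇔B′ (⇔.sym B⇔B′)))

suc-≡⇔ : {i j : ℕ} → i ≡ j ⇔ suc i ≡ suc j
suc-≡⇔ = mk⇔ (cong suc) ℕ.suc-injective

injective⇒surjective : {f : Fin n → Fin n} → Injective _≡_ _≡_ f → ∀ y → ∃[ x ] f x ≡ y
injective⇒surjective {suc m} {f} f-inj y with any? (λ x → f x ≟ y)
... | yes hit = hit
... | no miss
  with i , j , i<j , eq ← pigeonhole (ℕ.n<1+n m) (λ x → punchOut {i = y} (λ e → miss (x , sym e)))
  = contradiction (f-inj (punchOut-injective (λ e → miss (i , sym e)) (λ e → miss (j , sym e)) eq))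
                  (<⇒≢ i<j)

≢fromℕ⇒< : {i : Fin (suc m)} → i ≢ fromℕ m → i < fromℕ m
≢fromℕ⇒< {i = i} = ≤∧≢⇒< (≤fromℕ i)

<fromℕ⇔≢ : {i : Fin (suc m)} → i < fromℕ m ⇔ i ≢ fromℕ m
<fromℕ⇔≢ = mk⇔ <⇒≢ ≢fromℕ⇒<

fromℕ≮ : (i : Fin (suc m)) → ¬ fromℕ m < i
fromℕ≮ i = ℕ.≤⇒≯ (≤fromℕ i)

≢fromℕ⇒toℕ< : {i : Fin (suc m)} → i ≢ fromℕ m → toℕ i ℕ.< m
≢fromℕ⇒toℕ< {m} i≢top = subst (ℕ._<_ _) (toℕ-fromℕ m) (≢fromℕ⇒< i≢top)

toℕ-cycSucc : (i : Fin (suc m)) → i ≢ fromℕ m → toℕ (cycSucc i) ≡ suc (toℕ i)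
toℕ-cycSucc {m} i i≢top with suc (toℕ i) ℕ.<? suc m
... | yes 1+i<1+m = toℕ-fromℕ< 1+i<1+m
... | no 1+i≮1+m = contradiction (s≤s (≢fromℕ⇒toℕ< i≢top)) 1+i≮1+m

cycSucc-fromℕ : ∀ m → cycSucc (fromℕ m) ≡ zero
cycSucc-fromℕ m with suc (toℕ (fromℕ m)) ℕ.<? suc m
... | yes 1+m<1+m = contradiction (toℕ-fromℕ m) (ℕ.<⇒≢ (ℕ.s<s⁻¹ 1+m<1+m))
... | no _ = refl

cycSucc-mono-⇔ : {u v : Fin (suc m)} → u ≢ fromℕ m → v ≢ fromℕ m →
  u < v ⇔ cycSucc u < cycSucc v
cycSucc-mono-⇔ {u = u} {v} u≢top v≢top = mk⇔
  (λ u<v → subst₂ ℕ._<_ (sym (toℕ-cycSucc u u≢top)) (sym (toℕ-cycSucc v v≢top)) (s<s u<v))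
  (λ su<sv → ℕ.s<s⁻¹ (subst₂ ℕ._<_ (toℕ-cycSucc u u≢top) (toℕ-cycSucc v v≢top) su<sv))

cycPred-cycSucc : (i : Fin n) → cycPred (cycSucc i) ≡ i
cycPred-cycSucc {suc m} i with i ≟ fromℕ m
... | yes refl rewrite cycSucc-fromℕ m = refl
... | no i≢top with cycSucc i | toℕ-cycSucc i i≢top
... | suc j | eq = toℕ-injective (trans (toℕ-inject₁ j) (ℕ.suc-injective eq))

cycSucc-cycPred : (i : Fin n) → cycSucc (cycPred i) ≡ i
cycSucc-cycPred {suc m} zero = cycSucc-fromℕ m
cycSucc-cycPred {suc m} (suc j) =
  toℕ-injective (trans (toℕ-cycSucc (inject₁ j) (fromℕ≢inject₁ ∘ sym))
                       (cong suc (toℕ-inject₁ j)))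

cycSucc-injective : Injective _≡_ _≡_ (cycSucc {n})
cycSucc-injective {x = i} {j} eq = begin
  i                   ≡⟨ sym (cycPred-cycSucc i) ⟩
  cycPred (cycSucc i) ≡⟨ cong cycPred eq ⟩
  cycPred (cycSucc j) ≡⟨ cycPred-cycSucc j ⟩
  j                   ∎
  where open ≡-Reasoning

cycPred-injective : Injective _≡_ _≡_ (cycPred {n})
cycPred-injective {x = i} {j} eq = begin
  i                   ≡⟨ sym (cycSucc-cycPred i) ⟩
  cycSucc (cycPred i) ≡⟨ cong cycSucc eq ⟩
  cycSucc (cycPred j) ≡⟨ cycSucc-cycPred j ⟩
  j                   ∎
  where open ≡-Reasoning

cycSucc≡zero⇒≡fromℕ : {i : Fin (suc m)} → cycSucc i ≡ zero → i ≡ fromℕ m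
cycSucc≡zero⇒≡fromℕ {m} eq = cycSucc-injective (trans eq (sym (cycSucc-fromℕ m)))

≮cycSucc-fromℕ : {i : Fin (suc m)} → ¬ i < cycSucc (fromℕ m)
≮cycSucc-fromℕ {m} {i} lt = contradiction (subst (i <_) (cycSucc-fromℕ m) lt) λ ()

cycSucc-fromℕ<cycSucc : {i : Fin (suc m)} → i ≢ fromℕ m → cycSucc (fromℕ m) < cycSucc i
cycSucc-fromℕ<cycSucc {m} {i} i≢top rewrite cycSucc-fromℕ m =
  subst (ℕ._<_ 0) (sym (toℕ-cycSucc i i≢top)) z<s

-- cycSucc is monotone away from the top element, which it sends to the minimum.
<-cycSucc-⇔ : {u v : Fin (suc m)} {s t : Fin (suc k)} →
  u ≡ fromℕ m ⇔ s ≡ fromℕ k → v ≡ fromℕ m ⇔ t ≡ fromℕ k →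
  (u < v ⇔ s < t) ⇔ (cycSucc u < cycSucc v ⇔ cycSucc s < cycSucc t)
<-cycSucc-⇔ {m} {k} {u} {v} u⇔s v⇔t with v ≟ fromℕ m | u ≟ fromℕ m
... | yes refl | _ with refl ← to v⇔t refl =
  inhabited⇒⇔ (⇔.trans <fromℕ⇔≢ (⇔.trans (¬-cong-⇔ u⇔s) (⇔.sym <fromℕ⇔≢)))
              (empty⇒⇔ ≮cycSucc-fromℕ ≮cycSucc-fromℕ)
... | no v≢top | yes refl with refl ← to u⇔s refl =
  inhabited⇒⇔ (empty⇒⇔ (fromℕ≮ v) (fromℕ≮ _))
              (inhabited⇒⇔ (cycSucc-fromℕ<cycSucc v≢top)
                           (cycSucc-fromℕ<cycSucc (v≢top ∘ from v⇔t)))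
... | no v≢top | no u≢top =
  ⇔-cong-⇔ (cycSucc-mono-⇔ u≢top v≢top)
           (cycSucc-mono-⇔ (u≢top ∘ from u⇔s) (v≢top ∘ from v⇔t))

below-just : (a : Fin (suc k)) (c : Fin k) → below a ≡ just c → toℕ c ≡ toℕ a
below-just {zero} a c ()
below-just {suc k} zero .zero refl = refl
below-just {suc k} (suc a) c eq with below a in eq′
below-just {suc k} (suc a) .(suc d) refl | just d = cong suc (below-just a d eq′)

just-below : (a : Fin (suc k)) (c : Fin k) → toℕ c ≡ toℕ a → below a ≡ just c
just-below {suc k} zero zero _ = refl
just-below {suc k} (suc a) (suc c) eq rewrite just-below a c (ℕ.suc-injective eq) = refl

-- y lies in gap g of the k points i ↦ (rank i, val i), ranks counted from 0:
-- strictly between the values of the points of rank g − 1 and g, a missing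
-- point imposing no bound.  Column a of an occurrence ι is gap a of
-- (id, ι), and row b is gap b of (τ, π ∘ ι).
InGap : (Fin k → Fin k) → (Fin k → Fin n) → Fin (suc k) → Fin n → Set
InGap rank val g y =
  (∀ i → suc (toℕ (rank i)) ≡ toℕ g → val i < y) ×
  (∀ i → toℕ (rank i) ≡ toℕ g → y < val i)

inGap-resp : {rank : Fin k → Fin k} {val val′ : Fin k → Fin n} {g : Fin (suc k)}
  {y y′ : Fin n} →
  (∀ i → val i ≡ val′ i) → y ≡ y′ → InGap rank val g y → InGap rank val′ g y′
inGap-resp val≗ refl (after , before) =
  (λ i e → subst (_< _) (val≗ i) (after i e)) , (λ i e → subst (_ <_) (val≗ i) (before i e))

inGap-fromℕ : {rank : Fin k → Fin k} {val : Fin k → Fin n} {y : Fin n} →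
  (∀ i → val i < y) → InGap rank val (fromℕ k) y
inGap-fromℕ {k} {rank = rank} below =
  (λ i _ → below i) ,
  (λ i e → contradiction (trans e (toℕ-fromℕ k)) (ℕ.<⇒≢ (toℕ<n (rank i))))

inGap-zero : {rank : Fin k → Fin k} {val : Fin k → Fin n} {y : Fin n} →
  (∀ i → y < val i) → InGap rank val zero y
inGap-zero above = (λ _ ()) , (λ i _ → above i)

Cell : (Fin n → Fin n) → (Fin k → Fin k) → (Fin k → Fin n) →
  Fin (suc k) → Fin (suc k) → Fin n → Set
Cell π τ ι a b x = InGap id ι a x × InGap τ (π ∘ ι) b (π x)

ShadedCellsEmpty : (Fin n → Fin n) → (Fin k → Fin k) → (Fin (suc k) → Fin (suc k) → Bool) →
  (Fin k → Fin n) → Set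
ShadedCellsEmpty π τ R ι = ∀ a b → R a b ≡ true → ∀ x → ¬ Cell π τ ι a b x

module _ (π : Fin n → Fin n) (p : MeshPattern) (ι : Fin (len p) → Fin n) where
  open Occ π p ι

  inColumn⇔inGap : ∀ {a x} → InColumn a x ⇔ InGap id ι a x
  inColumn⇔inGap = mk⇔ (λ c → after c , before c) fromGap
    where
    after : ∀ {a x} → InColumn a x → ∀ i → suc (toℕ i) ≡ toℕ a → ι i < x
    after {suc a} (ιa<x , _) i e =
      subst (λ j → ι j < _) (sym (toℕ-injective (ℕ.suc-injective e))) ιa<x
    before : ∀ {a x} → InColumn a x → ∀ i → toℕ i ≡ toℕ a → x < ι i
    before {a} {x} (_ , r) i e with below a in eq
    ... | just c = subst (λ j → x < ι j) (toℕ-injective (trans (below-just a c eq) (sym e))) r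
    ... | nothing with () ← trans (sym eq) (just-below a i e)
    fromGap : ∀ {a x} → InGap id ι a x → InColumn a x
    fromGap {zero} (_ , before) with below {len p} zero in eq
    ... | just c = _ , before c (below-just zero c eq)
    ... | nothing = _
    fromGap {suc a} (after , before) with below (suc a) in eq
    ... | just c = after a refl , before c (below-just (suc a) c eq)
    ... | nothing = after a refl , _

  inRow⇔inGap : ∀ {b y} → InRow b y ⇔ InGap (τ p) (π ∘ ι) b y
  inRow⇔inGap = mk⇔ (λ r → after r , before r) fromGap
    where
    after : ∀ {b y} → InRow b y → ∀ i → suc (toℕ (τ p i)) ≡ toℕ b → π (ι i) < y
    after {suc c} (above , _) i e = above i (toℕ-injective (ℕ.suc-injective e))
    before : ∀ {b y} → InRow b y → ∀ i → toℕ (τ p i) ≡ toℕ b → y < π (ι i)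
    before {b} (_ , r) i e with below b in eq
    ... | just c = r i (toℕ-injective (trans e (sym (below-just b c eq))))
    ... | nothing with () ← trans (sym eq) (just-below b (τ p i) e)
    fromGap : ∀ {b y} → InGap (τ p) (π ∘ ι) b y → InRow b y
    fromGap {zero} (_ , before) with below {len p} zero in eq
    ... | just c = _ , λ i τi≡c → before i (trans (cong toℕ τi≡c) (below-just zero c eq))
    ... | nothing = _
    fromGap {suc b} (after , before) with below (suc b) in eq
    ... | just c = (λ i τi≡b → after i (cong (suc ∘ toℕ) τi≡b))
                 , λ i τi≡c → before i (trans (cong toℕ τi≡c) (below-just (suc b) c eq))
    ... | nothing = (λ i τi≡b → after i (cong (suc ∘ toℕ) τi≡b)) , _

  shading⇔ : (∀ a b → R p a b ≡ true → ¬ (∃[ x ] InColumn a x × InRow b (π x))) ⇔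
             ShadedCellsEmpty π (τ p) (R p) ι
  shading⇔ = mk⇔
    (λ empty a b shaded x (col , row) →
       empty a b shaded (x , from inColumn⇔inGap col , from inRow⇔inGap row))
    (λ empty a b shaded (x , col , row) →
       empty a b shaded x (to inColumn⇔inGap col , to inRow⇔inGap row))

  occurrence⇒increasing : IsOccurrence π p ι → ι Preserves _<_ ⟶ _<_
  occurrence⇒increasing (increasing , _) = increasing _ _

  occurrence⇒shadedCellsEmpty : IsOccurrence π p ι → ShadedCellsEmpty π (τ p) (R p) ι
  occurrence⇒shadedCellsEmpty (_ , _ , shading) = to shading⇔ shading

<-preserving⇒injective : {ι : Fin k → Fin n} → ι Preserves _<_ ⟶ _<_ → Injective _≡_ _≡_ ι
<-preserving⇒injective inc {i} {j} eq with <-cmp i j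
... | tri< i<j _ _ = contradiction eq (<⇒≢ (inc i<j))
... | tri≈ _ i≡j _ = i≡j
... | tri> _ _ j<i = contradiction (sym eq) (<⇒≢ (inc j<i))

<-preserving⇒≤-preserving : {ι : Fin k → Fin n} →
  ι Preserves _<_ ⟶ _<_ → ι Preserves _≤_ ⟶ _≤_
<-preserving⇒≤-preserving inc {i} {j} i≤j with ℕ.m≤n⇒m<n∨m≡n i≤j
... | inj₁ i<j = ℕ.<⇒≤ (inc i<j)
... | inj₂ i≡j rewrite toℕ-injective {i = i} {j} i≡j = ℕ.≤-refl

∃-gap : {ι : Fin k → Fin n} → ι Preserves _<_ ⟶ _<_ → ∀ {x} → (∀ i → ι i ≢ x) →
  ∃[ a ] InGap id ι a x
∃-gap {zero} _ _ = zero , (λ ()) , (λ ())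
∃-gap {suc k} {ι = ι} inc {x} x∉ι with <-cmp x (ι zero)
... | tri< x<ι₀ _ _ = zero , (λ _ ()) , λ { zero _ → x<ι₀ }
... | tri≈ _ x≡ι₀ _ = contradiction (sym x≡ι₀) (x∉ι zero)
... | tri> _ _ ι₀<x with a , after , before ← ∃-gap (λ i<j → inc (s<s i<j)) (x∉ι ∘ suc) =
  suc a , after′ , before′
  where
  after′ : ∀ i → suc (toℕ i) ≡ toℕ (suc a) → ι i < x
  after′ zero _ = ι₀<x
  after′ (suc i) e = after i (ℕ.suc-injective e)
  before′ : ∀ i → toℕ i ≡ toℕ (suc a) → x < ι i
  before′ (suc i) e = before i (ℕ.suc-injective e)

inGap-id⇒∉ : {ι : Fin k → Fin n} → ι Preserves _<_ ⟶ _<_ → ∀ {a x} → InGap id ι a x →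
  ∀ i → ι i ≢ x
inGap-id⇒∉ {k} inc {a} (after , before) i refl with toℕ i ℕ.<? toℕ a
inGap-id⇒∉ {k} inc {suc a} (after , _) i refl | yes i<1+a =
  ℕ.<⇒≱ (after a refl) (<-preserving⇒≤-preserving inc (ℕ.s≤s⁻¹ i<1+a))
... | no i≮a = ℕ.<⇒≱ (before c (toℕ-fromℕ< a<k)) (<-preserving⇒≤-preserving inc c≤i)
  where
  a<k : toℕ a ℕ.< k
  a<k = ℕ.≤-<-trans (ℕ.≮⇒≥ i≮a) (toℕ<n i)
  c = fromℕ< a<k
  c≤i : c ≤ i
  c≤i = subst (ℕ._≤ toℕ i) (sym (toℕ-fromℕ< a<k)) (ℕ.≮⇒≥ i≮a)

shadedRow⇒occupied : {π : Fin n → Fin n} {p : MeshPattern} {ι : Fin (len p) → Fin n} →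
  IsOccurrence π p ι → ∀ {b x} → (∀ a → R p a b ≡ true) →
  ((∀ i → ι i ≢ x) → InGap (τ p) (π ∘ ι) b (π x)) → ∃[ i ] ι i ≡ x
shadedRow⇒occupied {π = π} {p} {ι} occ {b} {x} shaded x∈row with any? (λ i → ι i ≟ x)
... | yes hit = hit
... | no miss with a , x∈col ← ∃-gap (occurrence⇒increasing π p ι occ) (λ i e → miss (i , e)) =
  contradiction (x∈col , x∈row (λ i e → miss (i , e)))
                (occurrence⇒shadedCellsEmpty π p ι occ a b (shaded a) x)

shadedTopRow⇒max∈image : {π : Fin (suc m) → Fin (suc m)} {p : MeshPattern}
  {ι : Fin (len p) → Fin (suc m)} → IsPerm π → IsOccurrence π p ι →
  (∀ a → R p a (fromℕ (len p)) ≡ true) → ∃[ i ] π (ι i) ≡ fromℕ m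
shadedTopRow⇒max∈image {m} {π} {ι = ι} π-injective occ shaded
  with x , πx≡top ← injective⇒surjective π-injective (fromℕ m)
  with i , ιi≡x ← shadedRow⇒occupied occ shaded (λ x∉ι → inGap-fromℕ λ i →
         subst (π (ι i) <_) (sym πx≡top)
               (≢fromℕ⇒< λ e → x∉ι i (π-injective (trans e (sym πx≡top)))))
  = i , trans (cong π ιi≡x) πx≡top

shadedBottomRow⇒zero∈image : {π : Fin (suc m) → Fin (suc m)} {p : MeshPattern}
  {ι : Fin (len p) → Fin (suc m)} → IsPerm π → IsOccurrence π p ι →
  (∀ a → R p a zero ≡ true) → ∃[ i ] π (ι i) ≡ zero
shadedBottomRow⇒zero∈image {π = π} {ι = ι} π-injective occ shaded
  with x , πx≡0 ← injective⇒surjective π-injective zero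
  with i , ιi≡x ← shadedRow⇒occupied occ shaded (λ x∉ι → inGap-zero λ i →
         subst (_< π (ι i)) (sym πx≡0)
               (≤∧≢⇒< z≤n λ e → x∉ι i (π-injective (trans (sym e) (sym πx≡0)))))
  = i , trans (cong π ιi≡x) πx≡0

module _ {w : Fin (suc k) → Fin (suc m)} {τ : Fin (suc k) → Fin (suc k)}
         (τ-injective : Injective _≡_ _≡_ τ) (w≅τ : ∀ j j′ → w j < w j′ ⇔ τ j < τ j′) where

  maximum⇒top-rank : ∀ {j₀} → w j₀ ≡ fromℕ m → τ j₀ ≡ fromℕ k
  maximum⇒top-rank {j₀} wj₀≡top with τ j₀ ≟ fromℕ k
  ... | yes τj₀≡top = τj₀≡top
  ... | no τj₀≢top with j₁ , τj₁≡top ← injective⇒surjective τ-injective (fromℕ k) =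
    contradiction (subst (_< w j₁) wj₀≡top (from (w≅τ j₀ j₁) τj₀<τj₁)) (fromℕ≮ (w j₁))
    where
    τj₀<τj₁ : τ j₀ < τ j₁
    τj₀<τj₁ = subst (τ j₀ <_) (sym τj₁≡top) (≢fromℕ⇒< τj₀≢top)

  minimum⇒bottom-rank : ∀ {j₀} → w j₀ ≡ zero → τ j₀ ≡ zero
  minimum⇒bottom-rank {j₀} wj₀≡0 with τ j₀ ≟ zero
  ... | yes τj₀≡0 = τj₀≡0
  ... | no τj₀≢0 with j₁ , τj₁≡0 ← injective⇒surjective τ-injective zero =
    contradiction (subst (w j₁ <_) wj₀≡0 (from (w≅τ j₁ j₀) τj₁<τj₀)) λ ()
    where
    τj₁<τj₀ : τ j₁ < τ j₀
    τj₁<τj₀ = subst (_< τ j₀) (sym τj₁≡0) (≤∧≢⇒< z≤n (τj₀≢0 ∘ sym))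

-- Row b of an occurrence containing the maximum at top rank becomes row b + 1
-- after the up-shift; the top row (empty, being above the maximum) becomes the
-- bottom row (empty, being below the new minimum).
inGap-cycSucc : {w : Fin (suc k) → Fin (suc m)} {τ : Fin (suc k) → Fin (suc k)} →
  (∀ j → w j ≡ fromℕ m ⇔ τ j ≡ fromℕ k) → ∀ {j₀} → τ j₀ ≡ fromℕ k →
  ∀ {b y} → y ≢ fromℕ m →
  InGap τ w b y ⇔ InGap (cycSucc ∘ τ) (cycSucc ∘ w) (cycSucc b) (cycSucc y)
inGap-cycSucc {k} {m} {w} {τ} top⇔ {j₀} τj₀≡top {b} {y} y≢top with b ≟ fromℕ (suc k)
... | yes refl = empty⇒⇔
  (λ (after , _) → fromℕ≮ y (subst (_< y) wj₀≡top (after j₀ (cong (suc ∘ toℕ) τj₀≡top))))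
  (λ (_ , before) → ≮cycSucc-fromℕ
     (subst (cycSucc y <_) (cong cycSucc wj₀≡top) (before j₀ cycSucc-ranks-zero)))
  where
  wj₀≡top : w j₀ ≡ fromℕ m
  wj₀≡top = from (top⇔ j₀) τj₀≡top
  cycSucc-ranks-zero : toℕ (cycSucc (τ j₀)) ≡ toℕ (cycSucc (fromℕ (suc k)))
  cycSucc-ranks-zero = trans (cong (toℕ ∘ cycSucc) τj₀≡top)
                             (trans (cong toℕ (cycSucc-fromℕ k)) (sym (cong toℕ (cycSucc-fromℕ (suc k)))))
... | no b≢top = ∀-cong-⇔ after⇔ ×-⇔ ∀-cong-⇔ before⇔
  where
  after⇔ : ∀ i → (suc (toℕ (τ i)) ≡ toℕ b → w i < y) ⇔
                 (suc (toℕ (cycSucc (τ i))) ≡ toℕ (cycSucc b) → cycSucc (w i) < cycSucc y)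
  after⇔ i with τ i ≟ fromℕ k
  ... | yes τi≡top = inhabited⇒⇔
    (λ e → contradiction (trans (sym e) (trans (cong (suc ∘ toℕ) τi≡top) (cong suc (toℕ-fromℕ k))))
                         (ℕ.<⇒≢ (≢fromℕ⇒toℕ< b≢top)))
    (λ _ → subst (_< cycSucc y) (sym (cong cycSucc (from (top⇔ i) τi≡top)))
                 (cycSucc-fromℕ<cycSucc y≢top))
  ... | no τi≢top rewrite toℕ-cycSucc (τ i) τi≢top | toℕ-cycSucc b b≢top =
    →-cong-⇔ suc-≡⇔ (cycSucc-mono-⇔ (τi≢top ∘ to (top⇔ i)) y≢top)
  before⇔ : ∀ i → (toℕ (τ i) ≡ toℕ b → y < w i) ⇔
                  (toℕ (cycSucc (τ i)) ≡ toℕ (cycSucc b) → cycSucc y < cycSucc (w i))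
  before⇔ i with τ i ≟ fromℕ k
  ... | yes τi≡top = inhabited⇒⇔
    (λ _ → subst (y <_) (sym (from (top⇔ i) τi≡top)) (≢fromℕ⇒< y≢top))
    (λ e → contradiction (trans (sym (cong toℕ (trans (cong cycSucc τi≡top) (cycSucc-fromℕ k))))
                                (trans e (toℕ-cycSucc b b≢top))) λ ())
  ... | no τi≢top rewrite toℕ-cycSucc (τ i) τi≢top | toℕ-cycSucc b b≢top =
    →-cong-⇔ suc-≡⇔ (cycSucc-mono-⇔ y≢top (τi≢top ∘ to (top⇔ i)))

module _ {m k : ℕ} {τ : Fin (suc k) → Fin (suc k)} {R : Fin (suc (suc k)) → Fin (suc (suc k)) → Bool}
         {π σ : Fin (suc m) → Fin (suc m)} (τ-injective : Injective _≡_ _≡_ τ)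
         (π-injective : Injective _≡_ _≡_ π) (σ≗ : ∀ x → σ x ≡ cycSucc (π x))
         {ι : Fin (suc k) → Fin (suc m)} (ι-increasing : ι Preserves _<_ ⟶ _<_)
         {j₀ : Fin (suc k)} (πιj₀≡top : π (ι j₀) ≡ fromℕ m) (τj₀≡top : τ j₀ ≡ fromℕ k)
         where

  private
    p q : MeshPattern
    p = mesh (suc k) τ R
    q = upMesh p

  max⇔top-rank : ∀ j → π (ι j) ≡ fromℕ m ⇔ τ j ≡ fromℕ k
  max⇔top-rank j = mk⇔
    (λ e → trans (cong τ (<-preserving⇒injective ι-increasing (π-injective (trans e (sym πιj₀≡top)))))
                 τj₀≡top)
    (λ e → trans (cong (π ∘ ι) (τ-injective (trans e (sym τj₀≡top)))) πιj₀≡top)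

  orderIso⇔ : ∀ j j′ → (π (ι j) < π (ι j′) ⇔ τ j < τ j′) ⇔
                       (σ (ι j) < σ (ι j′) ⇔ cycSucc (τ j) < cycSucc (τ j′))
  orderIso⇔ j j′ rewrite σ≗ (ι j) | σ≗ (ι j′) =
    <-cycSucc-⇔ (max⇔top-rank j) (max⇔top-rank j′)

  cell⇔ : ∀ {a b x} → Cell π τ ι a b x ⇔ Cell σ (cycSucc ∘ τ) ι a (cycSucc b) x
  cell⇔ {a} {b} {x} = mk⇔
    (λ (col , row) → col , inGap-resp (sym ∘ σ≗ ∘ ι) (sym (σ≗ x)) (to (row⇔ col) row))
    (λ (col , row) → col , from (row⇔ col) (inGap-resp (σ≗ ∘ ι) (σ≗ x) row))
    where
    row⇔ : InGap id ι a x →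
      InGap τ (π ∘ ι) b (π x) ⇔
      InGap (cycSucc ∘ τ) (cycSucc ∘ π ∘ ι) (cycSucc b) (cycSucc (π x))
    row⇔ col = inGap-cycSucc max⇔top-rank τj₀≡top
      (λ πx≡top → inGap-id⇒∉ ι-increasing col j₀
                    (π-injective (trans πιj₀≡top (sym πx≡top))))

  shadedCellsEmpty⇔ :
    ShadedCellsEmpty π τ R ι ⇔ ShadedCellsEmpty σ (cycSucc ∘ τ) (λ a b → R a (cycPred b)) ι
  shadedCellsEmpty⇔ = mk⇔
    (λ empty a b shaded x cell → empty a (cycPred b) shaded x
       (from cell⇔ (subst (λ g → Cell σ (cycSucc ∘ τ) ι a g x) (sym (cycSucc-cycPred b)) cell)))
    (λ empty a b shaded x cell → empty a (cycSucc b)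
       (subst (λ g → R a g ≡ true) (sym (cycPred-cycSucc b)) shaded) x (to cell⇔ cell))

  isOccurrence-upShift : IsOccurrence π p ι ⇔ IsOccurrence σ q ι
  isOccurrence-upShift = mk⇔
    (λ (inc , ord , sh) → inc , (λ j j′ → to (orderIso⇔ j j′) (ord j j′)) ,
       from (shading⇔ σ q ι) (to shadedCellsEmpty⇔ (to (shading⇔ π p ι) sh)))
    (λ (inc , ord , sh) → inc , (λ j j′ → from (orderIso⇔ j j′) (ord j j′)) ,
       from (shading⇔ π p ι) (from shadedCellsEmpty⇔ (to (shading⇔ σ q ι) sh)))

contains-in-empty : {π σ : Fin 0 → Fin 0} {τ τ′ : Fin k → Fin k}
  {R R′ : Fin (suc k) → Fin (suc k) → Bool} → Contains π (mesh k τ R) → Contains σ (mesh k τ′ R′)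
contains-in-empty (ι , inc , _) =
  ι , inc , (λ j → ⊥-elim (¬Fin0 (ι j))) , (λ _ _ _ (x , _) → ¬Fin0 x)

cycSucc∘-injective : {π σ : Fin n → Fin n} → Injective _≡_ _≡_ π → (∀ x → σ x ≡ cycSucc (π x)) →
  Injective _≡_ _≡_ σ
cycSucc∘-injective π-injective σ≗ e =
  π-injective (cycSucc-injective (trans (sym (σ≗ _)) (trans e (σ≗ _))))

contains-upShift : (p : MeshPattern) → Injective _≡_ _≡_ (τ p) →
  (∀ a → R p a (fromℕ (len p)) ≡ true) → {π σ : Fin n → Fin n} → IsPerm π →
  (∀ x → σ x ≡ cycSucc (π x)) → Contains π p ⇔ Contains σ (upMesh p)
contains-upShift {zero} (mesh _ _ _) _ _ _ _ = mk⇔ contains-in-empty contains-in-empty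
contains-upShift {suc m} (mesh zero _ _) _ topShaded π-injective σ≗ = empty⇒⇔
  (λ (_ , occ) → ¬Fin0 (proj₁ (shadedTopRow⇒max∈image π-injective occ topShaded)))
  (λ (_ , occ) → ¬Fin0 (proj₁ (shadedBottomRow⇒zero∈image
                                  (cycSucc∘-injective π-injective σ≗) occ topShaded)))
contains-upShift {suc m} p@(mesh (suc k) τ R) τ-injective topShaded {π} {σ} π-injective σ≗ = mk⇔ up down
  where
  up : Contains π p → Contains σ (upMesh p)
  up (ι , occ@(_ , ord , _))
    with j₀ , πιj₀≡top ← shadedTopRow⇒max∈image π-injective occ topShaded =
    ι , to (isOccurrence-upShift τ-injective π-injective σ≗ (occurrence⇒increasing π p ι occ)
              πιj₀≡top (maximum⇒top-rank τ-injective ord πιj₀≡top)) occ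
  down : Contains σ (upMesh p) → Contains π p
  down (ι , occ@(_ , ord , _))
    with j₀ , σιj₀≡0 ← shadedBottomRow⇒zero∈image (cycSucc∘-injective π-injective σ≗)
                                                   occ topShaded =
    ι , from (isOccurrence-upShift τ-injective π-injective σ≗ (occurrence⇒increasing σ (upMesh p) ι occ)
                πιj₀≡top τj₀≡top) occ
    where
    πιj₀≡top : π (ι j₀) ≡ fromℕ m
    πιj₀≡top = cycSucc≡zero⇒≡fromℕ (trans (sym (σ≗ (ι j₀))) σιj₀≡0)
    τj₀≡top : τ j₀ ≡ fromℕ k
    τj₀≡top = cycSucc≡zero⇒≡fromℕ
      (minimum⇒bottom-rank (λ e → τ-injective (cycSucc-injective e)) ord σιj₀≡0)

proposition3p3 : (p : MeshPattern) → Injective _≡_ _≡_ (τ p) →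
    (∀ a → R p a (fromℕ (len p)) ≡ true) →
    ((n : ℕ) (π : Fin n → Fin n) → IsPerm π →
      (Avoids π p ⇔ Avoids (upPerm π) (upMesh p)))
    × WilfEquivalent p (upMesh p)
proposition3p3 p τ-injective topShaded = avoids⇔ , wilf
  where
  contains⇔ : ∀ {n} {π σ : Fin n → Fin n} → IsPerm π → (∀ x → σ x ≡ cycSucc (π x)) →
    Contains π p ⇔ Contains σ (upMesh p)
  contains⇔ = contains-upShift p τ-injective topShaded
  avoids⇔ : (n : ℕ) (π : Fin n → Fin n) → IsPerm π → Avoids π p ⇔ Avoids (upPerm π) (upMesh p)
  avoids⇔ _ _ π-injective = ¬-cong-⇔ (contains⇔ π-injective (λ _ → refl))
  wilf : WilfEquivalent p (upMesh p)
  wilf n = up , down , (λ (π , _) i → cycPred-cycSucc (π i)) , (λ (σ , _) i → cycSucc-cycPred (σ i))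
    where
    up : Av n p → Av n (upMesh p)
    up (π , π-injective , π-avoids) =
      upPerm π , cycSucc∘-injective π-injective (λ _ → refl) , to (avoids⇔ n π π-injective) π-avoids
    down : Av n (upMesh p) → Av n p
    down (σ , σ-injective , σ-avoids) =
      cycPred ∘ σ , ρ-injective ,
      λ ρ-contains → σ-avoids (to (contains⇔ ρ-injective (sym ∘ cycSucc-cycPred ∘ σ)) ρ-contains)
      where
      ρ-injective : IsPerm (cycPred ∘ σ)
      ρ-injective e = σ-injective (cycPred-injective e)
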